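{- Suppose that either ($c\ge 2$ and $H=K_d$ for some $d\ge 3$) or ($c=1$ and $H$ is an arbitrary graph with at least $3$ vertices). Then there exists a $(c,H)$-coherent gadget $G$ with $|H|$ portal vertices that strictly $(c,H)$-realizes the relation $\mathrm{EQ}=\{(y,\dots,y)\in\{0,\dots,c\}^{|H|}: y\in\{0,\dots,c\}\}$. Furthermore, the size of $G$ is bounded by a constant.
   Context: $|H|$ is the number of vertices of $H$; $K_d$ is the complete graph on $d$ vertices. A gadget is a graph $G$ with designated portal vertices; the others are internal. An extension of $G$ is a graph $E$ containing $G$ as induced subgraph with $N_E(v)\subseteq V(G)$ for each internal $v$. A copy of $H$ is a subgraph isomorphic to $H$. A distinct (resp. multi) $(c,H)$-packing is a set (resp. multiset) of copies of $H$ covering each vertex at most $c$ times; a partitioning covers each exactly $c$ times. $G$ is $(c,H)$-coherent if for every extension $E$ and every multi or distinct $(c,H)$-partitioning $\mathcal{Z}$ of $E$, each $Z\in\mathcal{Z}$ meeting an internal vertex of $G$ satisfies $V(Z)\subseteq V(G)$. $G$ with portals $p_1,\dots,p_\ell$ distinctly (resp. arbitrarily) $(c,H)$-realizes $R\subseteq\{0,\dots,c\}^\ell$ if $r\in R$ iff some distinct (resp. multi) $(c,H)$-packing of $G$ covers each internal vertex exactly $c$ times and each $p_i$ exactly $r_i$ times; strictly means both. -}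

module Defs where

open import Data.Nat using (ℕ; zero; suc; _+_; _≤_)
open import Data.Bool using (Bool; true; false; if_then_else_)
open import Data.Fin using (Fin; _≟_)
open import Data.Fin.Properties using (any?)
open import Data.List using (List; []; _∷_)
open import Data.List.Membership.Propositional using (_∈_)
open import Data.List.Relation.Unary.AllPairs using (AllPairs)
open import Data.Product using (Σ; ∃; _×_; _,_)
open import Data.Sum using (_⊎_)
open import Relation.Nullary using (¬_; does)
open import Relation.Binary.PropositionalEquality using (_≡_; refl; sym)
open import Relation.Nullary using (yes; no)
open import Data.Empty using (⊥-elim)
open import Function using (Injective; _⇔_)

record Graph : Set where
  field
    size   : ℕ
    adj    : Fin size → Fin size → Bool
    adjSym    : ∀ u v → adj u v ≡ adj v u
    adjIrrefl : ∀ v → adj v v ≡ false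
open Graph public

∣_∣ᵥ : Graph → ℕ
∣ H ∣ᵥ = size H

K : ℕ → Graph
K d = record
  { size = d
  ; adj = λ u v → if does (u ≟ v) then false else true
  ; adjSym = symK
  ; adjIrrefl = irrK }
  where
  symK : ∀ (u v : Fin d) → (if does (u ≟ v) then false else true)
                         ≡ (if does (v ≟ u) then false else true)
  symK u v with u ≟ v | v ≟ u
  ... | yes _ | yes _ = refl
  ... | no _  | no _  = refl
  ... | yes p | no q  = ⊥-elim (q (sym p))
  ... | no p  | yes q = ⊥-elim (p (sym q))
  irrK : ∀ (v : Fin d) → (if does (v ≟ v) then false else true) ≡ false
  irrK v with v ≟ v
  ... | yes _ = refl
  ... | no p  = ⊥-elim (p refl)

-- A copy (subgraph of G isomorphic to H) is given by
-- an injective edge-preserving map f : V(H) → V(G); the copy itself is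
-- the subgraph with vertex set im f and edge set f(E(H)).  Two maps
-- describe the same copy iff these vertex and edge sets coincide.

record Emb (H G : Graph) : Set where
  field
    map  : Fin (size H) → Fin (size G)
    inj  : Injective _≡_ _≡_ map
    edge : ∀ u v → adj H u v ≡ true → adj G (map u) (map v) ≡ true
open Emb public

_∈V_ : ∀ {H G} → Fin (size G) → Emb H G → Set
x ∈V Z = ∃ λ u → map Z u ≡ x

EdgeIn : ∀ {H G} → Fin (size G) → Fin (size G) → Emb H G → Set
EdgeIn {H} x y Z = ∃ λ u → ∃ λ v → adj H u v ≡ true × map Z u ≡ x × map Z v ≡ y

SameCopy : ∀ {H G} → Emb H G → Emb H G → Set
SameCopy {H} {G} Z W =
  (∀ x → (x ∈V Z) ⇔ (x ∈V W)) × (∀ x y → EdgeIn x y Z ⇔ EdgeIn x y W)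

covers : ∀ {H G} → Emb H G → Fin (size G) → Bool
covers Z x = does (any? (λ u → map Z u ≟ x))

mult : ∀ {H G} → List (Emb H G) → Fin (size G) → ℕ
mult []       x = 0
mult (Z ∷ Zs) x = (if covers Z x then 1 else 0) + mult Zs x

-- multisets of copies are lists; sets of copies are lists of pairwise
-- distinct copies
Distinct : ∀ {H G} → List (Emb H G) → Set
Distinct Zs = AllPairs (λ Z W → ¬ SameCopy Z W) Zs

MultiPacking : ℕ → (H G : Graph) → List (Emb H G) → Set
MultiPacking c H G Zs = ∀ x → mult Zs x ≤ c

DistinctPacking : ℕ → (H G : Graph) → List (Emb H G) → Set
DistinctPacking c H G Zs = Distinct Zs × MultiPacking c H G Zs

MultiPartitioning : ℕ → (H G : Graph) → List (Emb H G) → Set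
MultiPartitioning c H G Zs = ∀ x → mult Zs x ≡ c

DistinctPartitioning : ℕ → (H G : Graph) → List (Emb H G) → Set
DistinctPartitioning c H G Zs = Distinct Zs × MultiPartitioning c H G Zs

record Gadget (ℓ : ℕ) : Set where
  field
    graph     : Graph
    portal    : Fin ℓ → Fin (size graph)
    portalInj : Injective _≡_ _≡_ portal
open Gadget public

Internal : ∀ {ℓ} (G : Gadget ℓ) → Fin (size (graph G)) → Set
Internal G v = ¬ (∃ λ i → portal G i ≡ v)

record Extension {ℓ} (G : Gadget ℓ) : Set where
  field
    ext     : Graph
    ι       : Fin (size (graph G)) → Fin (size ext)
    ιInj    : Injective _≡_ _≡_ ι
    induced : ∀ u v → adj ext (ι u) (ι v) ≡ adj (graph G) u v
    closed  : ∀ v → Internal G v → ∀ w → adj ext (ι v) w ≡ true →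
              ∃ λ u → ι u ≡ w
open Extension public

Coherent : ℕ → (H : Graph) → ∀ {ℓ} → Gadget ℓ → Set
Coherent c H G =
  ∀ (X : Extension G) (Zs : List (Emb H (ext X))) →
  (MultiPartitioning c H (ext X) Zs ⊎ DistinctPartitioning c H (ext X) Zs) →
  ∀ Z → Z ∈ Zs →
  (∃ λ v → Internal G v × (ι X v ∈V Z)) →
  ∀ w → w ∈V Z → ∃ λ u → ι X u ≡ w

-- Relations R ⊆ {0..c}^ℓ, as predicates on (Fin ℓ → ℕ).
Relation : ℕ → Set₁
Relation ℓ = (Fin ℓ → ℕ) → Set

Realizes-by : ℕ → (H : Graph) → ∀ {ℓ} (G : Gadget ℓ) → (Fin ℓ → ℕ) →
              List (Emb H (graph G)) → Set
Realizes-by c H G r Zs =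
  (∀ v → Internal G v → mult Zs v ≡ c) × (∀ i → mult Zs (portal G i) ≡ r i)

DistinctlyRealizes : ℕ → (H : Graph) → ∀ {ℓ} → Gadget ℓ → Relation ℓ → Set
DistinctlyRealizes c H {ℓ} G R =
  ∀ (r : Fin ℓ → ℕ) → (∀ i → r i ≤ c) →
  (R r ⇔ (∃ λ Zs → DistinctPacking c H (graph G) Zs × Realizes-by c H G r Zs))

ArbitrarilyRealizes : ℕ → (H : Graph) → ∀ {ℓ} → Gadget ℓ → Relation ℓ → Set
ArbitrarilyRealizes c H {ℓ} G R =
  ∀ (r : Fin ℓ → ℕ) → (∀ i → r i ≤ c) →
  (R r ⇔ (∃ λ Zs → MultiPacking c H (graph G) Zs × Realizes-by c H G r Zs))

StrictlyRealizes : ℕ → (H : Graph) → ∀ {ℓ} → Gadget ℓ → Relation ℓ → Set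
StrictlyRealizes c H G R = DistinctlyRealizes c H G R × ArbitrarilyRealizes c H G R

EQ : ℕ → (ℓ : ℕ) → Relation ℓ
EQ c ℓ r = ∃ λ y → y ≤ c × (∀ i → r i ≡ y)

Hyp : ℕ → Graph → Set
Hyp c H = (2 ≤ c × ∃ λ d → 3 ≤ d × H ≡ K d) ⊎ (c ≡ 1 × 3 ≤ ∣ H ∣ᵥ)

{-# OPTIONS --safe #-}
-- For H = K d the gadget is the complete d-partite graph whose parts have c + 1 vertices, one
-- of them the portal. A copy of K d through an internal vertex v lies in the neighbourhood of v,
-- so every gadget is K d-coherent. A copy of K d meets each part exactly once, so in each part
-- the multiplicities add up to the number of copies; since the c internal vertices of a part are
-- covered c times each, all portals are covered equally often. Conversely, write (a , b) for the
-- copy using slot a in the first part and slot b in all others: the c × c grid of internal pairs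
-- covers every internal vertex c times, and replacing the diagonal pairs (a , a) with a < y by
-- (portal , a) and (a , portal) covers every portal y times, all copies staying distinct.
-- For c = 1 the gadget is H with every vertex a portal: copies of H in H are spanning, so any
-- packing covers all portals equally often, and at most one copy is needed.
module Submission where

open import Defs
open import Data.Nat using (ℕ; zero; suc; _+_; _*_; _≤_; _<ᵇ_; z≤n; s≤s)
open import Data.Nat.Properties
  using (+-0-commutativeMonoid; +-identityʳ; *-identityʳ; +-cancelʳ-≡; n<1+n; ≤-refl; ≤-trans; ≤-reflexive)
open import Data.Nat.ListAction using (sum)
open import Data.Nat.ListAction.Properties using (sum-++)
open import Algebra.Properties.CommutativeMonoid.Sum +-0-commutativeMonoid
  using (sum-syntax; sum-cong-≗; sum-replicate-zero; ∑-distrib-+; ∑-comm)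
open import Data.Bool using (Bool; true; false; if_then_else_)
open import Data.Fin using (Fin; zero; suc; toℕ; _≟_; combine; remQuot; punchOut; fromℕ<)
open import Data.Fin.Properties
  using (any?; 0≢1+n; suc-injective; <⇒≢; pigeonhole; punchOut-injective;
         combine-injectiveˡ; combine-injectiveʳ; combine-surjective; combine-remQuot; remQuot-combine)
open import Data.List using (List; []; _∷_; _++_; length; concat; tabulate; replicate)
import Data.List as List
open import Data.List.Properties using (map-++; length-replicate)
open import Data.List.Relation.Unary.All as All using (All; []; _∷_)
import Data.List.Relation.Unary.All.Properties as All
open import Data.List.Relation.Unary.AllPairs as AllPairs using ([]; _∷_)
import Data.List.Relation.Unary.AllPairs.Properties as AllPairs
open import Data.List.Relation.Unary.Unique.Propositional using (Unique)
import Data.List.Relation.Unary.Unique.Propositional.Properties as Unique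
open import Data.List.Relation.Binary.Disjoint.Propositional using (Disjoint)
open import Data.Product using (Σ; ∃; _×_; _,_; proj₁; proj₂)
open import Data.Sum using (inj₁; inj₂)
open import Function using (_∘_; mk⇔; Injective; Equivalence)
open import Relation.Nullary using (does; yes; no; contradiction)
open import Relation.Nullary.Decidable using (dec-true; dec-false; does-⇔)
open import Relation.Binary.PropositionalEquality
  using (_≡_; _≢_; refl; sym; trans; cong; cong₂; subst; subst₂; module ≡-Reasoning)

open ≡-Reasoning

injective⇒surjective : ∀ {n} (f : Fin n → Fin n) → Injective _≡_ _≡_ f → ∀ x → ∃ λ u → f u ≡ x
injective⇒surjective {suc n} f f-inj x with any? (λ u → f u ≟ x)
... | yes hit = hit
... | no miss with pigeonhole (n<1+n n) (λ u → punchOut (λ x≡fu → miss (u , sym x≡fu)))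
... | u , v , u<v , same = contradiction (f-inj (punchOut-injective {i = x} _ _ same)) (<⇒≢ u<v)

unique-concat-tabulate : ∀ {A B : Set} {n} (f : Fin n → List A) (key : A → B) (ι : Fin n → B) →
  Injective _≡_ _≡_ ι → (∀ i → All (λ x → key x ≡ ι i) (f i)) → (∀ i → Unique (f i)) →
  Unique (concat (tabulate f))
unique-concat-tabulate {n = zero} f key ι ι-inj keyed unique = []
unique-concat-tabulate {n = suc n} f key ι ι-inj keyed unique =
  Unique.++⁺ (unique zero)
    (unique-concat-tabulate (f ∘ suc) key (ι ∘ suc) (λ eq → suc-injective (ι-inj eq))
                            (keyed ∘ suc) (unique ∘ suc))
    disjoint
  where
  later : All (λ x → ∃ λ i → key x ≡ ι (suc i)) (concat (tabulate (f ∘ suc)))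
  later = All.concat⁺ (All.tabulate⁺ (λ i → All.map (i ,_) (keyed (suc i))))
  disjoint : Disjoint (f zero) (concat (tabulate (f ∘ suc)))
  disjoint (x∈first , x∈later) with All.lookup later x∈later
  ... | i , key≡ = 0≢1+n (ι-inj (trans (sym (All.lookup (keyed zero) x∈first)) key≡))

strictlyRealizes-EQ : ∀ {c H ℓ} (G : Gadget ℓ) →
  (∀ y → y ≤ c → ∃ λ Zs → DistinctPacking c H (graph G) Zs × Realizes-by c H G (λ _ → y) Zs) →
  (∀ r → (∀ i → r i ≤ c) → ∀ Zs → Realizes-by c H G r Zs → EQ c ℓ r) →
  StrictlyRealizes c H G (EQ c ℓ)
strictlyRealizes-EQ {c} {H} {ℓ} G pack constant =
  (λ r r≤c → mk⇔ (packing r) (λ (Zs , _ , realizing) → constant r r≤c Zs realizing)) ,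
  (λ r r≤c → mk⇔ (λ eq → let (Zs , (_ , multi) , realizing) = packing r eq in Zs , multi , realizing)
                 (λ (Zs , _ , realizing) → constant r r≤c Zs realizing))
  where
  packing : ∀ r → EQ c ℓ r → ∃ λ Zs → DistinctPacking c H (graph G) Zs × Realizes-by c H G r Zs
  packing r (y , y≤c , r≡y) =
    let (Zs , distinct , internal , portals) = pack y y≤c
    in Zs , distinct , internal , λ i → trans (portals i) (sym (r≡y i))

-- Finite sums

indicator : Bool → ℕ
indicator b = if b then 1 else 0

δ : ∀ {n} → Fin n → Fin n → ℕ
δ s t = indicator (does (s ≟ t))

δ-comm : ∀ {n} (s t : Fin n) → δ s t ≡ δ t s
δ-comm s t = cong indicator (does-⇔ (mk⇔ sym sym) (s ≟ t) (t ≟ s))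

∑-one : ∀ n → ∑[ i < n ] 1 ≡ n
∑-one zero = refl
∑-one (suc n) = cong suc (∑-one n)

∑-δ-* : ∀ {n} (s : Fin n) w → ∑[ t < n ] (δ s t * w) ≡ w
∑-δ-* {suc n} zero w = trans (cong₂ _+_ (+-identityʳ w) (sum-replicate-zero n)) (+-identityʳ w)
∑-δ-* {suc n} (suc s) w = ∑-δ-* s w

∑-δ : ∀ {n} (s : Fin n) → ∑[ t < n ] δ s t ≡ 1
∑-δ s = trans (sum-cong-≗ (λ t → sym (*-identityʳ (δ s t)))) (∑-δ-* s 1)

∑-< : ∀ {n y} → y ≤ n → ∑[ a < n ] indicator (toℕ a <ᵇ y) ≡ y
∑-< {n} {zero} _ = sum-replicate-zero n
∑-< {suc n} {suc y} (s≤s y≤n) = cong suc (∑-< y≤n)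

sum-map-concat-tabulate : ∀ {A : Set} {n} (g : A → ℕ) (f : Fin n → List A) →
  sum (List.map g (concat (tabulate f))) ≡ ∑[ a < n ] sum (List.map g (f a))
sum-map-concat-tabulate {n = zero} g f = refl
sum-map-concat-tabulate {n = suc n} g f = begin
  sum (List.map g (f zero ++ concat (tabulate (f ∘ suc))))
    ≡⟨ cong sum (map-++ g (f zero) _) ⟩
  sum (List.map g (f zero) ++ List.map g (concat (tabulate (f ∘ suc))))
    ≡⟨ sum-++ (List.map g (f zero)) _ ⟩
  sum (List.map g (f zero)) + sum (List.map g (concat (tabulate (f ∘ suc))))
    ≡⟨ cong (sum (List.map g (f zero)) +_) (sum-map-concat-tabulate g (f ∘ suc)) ⟩
  ∑[ a < suc n ] sum (List.map g (f a)) ∎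

-- Complete graphs and complete multipartite graphs

K-adj-≢ : ∀ {d} {u v : Fin d} → u ≢ v → adj (K d) u v ≡ true
K-adj-≢ {u = u} {v} u≢v = cong (λ b → if b then false else true) (dec-false (u ≟ v) u≢v)

K-coherent : ∀ c d {ℓ} (G : Gadget ℓ) → Coherent c (K d) G
K-coherent c d G X Zs _ Z _ (v , v-internal , a , Za≡ιv) w (b , Zb≡w) with a ≟ b
... | yes refl = v , trans (sym Za≡ιv) Zb≡w
... | no a≢b = closed X v v-internal w
  (subst₂ (λ x y → adj (ext X) x y ≡ true) Za≡ιv Zb≡w (edge Z a b (K-adj-≢ a≢b)))

completeMultipartite : ∀ {n d} → (Fin n → Fin d) → Graph
completeMultipartite {n} {d} part = record
  { size      = n
  ; adj       = λ x y → adj (K d) (part x) (part y)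
  ; adjSym    = λ x y → adjSym (K d) (part x) (part y)
  ; adjIrrefl = λ x → adjIrrefl (K d) (part x)
  }

part-injective : ∀ {n d} (part : Fin n → Fin d) (Z : Emb (K d) (completeMultipartite part)) →
  Injective _≡_ _≡_ (part ∘ map Z)
part-injective {d = d} part Z {u} {v} same-part with u ≟ v
... | yes u≡v = u≡v
... | no u≢v = contradiction
  (trans (sym (edge Z u v (K-adj-≢ u≢v)))
         (trans (cong (λ w → adj (K d) w (part (map Z v))) same-part) (adjIrrefl (K d) (part (map Z v)))))
  (λ ())

sectionCopy : ∀ {n d} (part : Fin n → Fin d) (φ : Fin d → Fin n) → (∀ i → part (φ i) ≡ i) →
  Emb (K d) (completeMultipartite part)
sectionCopy {d = d} part φ section = record
  { map  = φ
  ; inj  = λ {i} {j} φi≡φj → trans (sym (section i)) (trans (cong part φi≡φj) (section j))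
  ; edge = λ u v uv → trans (cong₂ (adj (K d)) (section u) (section v)) uv
  }

sectionCopy-injective : ∀ {n d} (part : Fin n → Fin d) {φ ψ : Fin d → Fin n}
  (φ-section : ∀ i → part (φ i) ≡ i) (ψ-section : ∀ i → part (ψ i) ≡ i) →
  SameCopy (sectionCopy part φ φ-section) (sectionCopy part ψ ψ-section) → ∀ i → φ i ≡ ψ i
sectionCopy-injective part {φ} {ψ} φ-section ψ-section same i
  with Equivalence.to (proj₁ same (φ i)) (i , refl)
... | u , ψu≡φi with trans (sym (ψ-section u)) (trans (cong part ψu≡φi) (φ-section i))
... | refl = sym ψu≡φi

-- The gadget H with every vertex a portal (c = 1)

allPortals : (H : Graph) → Gadget ∣ H ∣ᵥ
allPortals H = record { graph = H ; portal = λ v → v ; portalInj = λ eq → eq }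

allPortals-coherent : ∀ c H → Coherent c H (allPortals H)
allPortals-coherent c H X Zs _ Z _ (v , v-internal , _) = contradiction (v , refl) v-internal

identityCopy : (H : Graph) → Emb H H
identityCopy H = record { map = λ v → v ; inj = λ eq → eq ; edge = λ _ _ uv → uv }

covers-spanning : ∀ {H} (Z : Emb H H) x → covers Z x ≡ true
covers-spanning Z x = dec-true (any? (λ u → map Z u ≟ x)) (injective⇒surjective (map Z) (inj Z) x)

mult-spanning : ∀ {H} (Zs : List (Emb H H)) x → mult Zs x ≡ length Zs
mult-spanning [] x = refl
mult-spanning (Z ∷ Zs) x = cong₂ _+_ (cong indicator (covers-spanning Z x)) (mult-spanning Zs x)

allPortals-realizes-EQ : ∀ {c} H → c ≤ 1 → Fin ∣ H ∣ᵥ → StrictlyRealizes c H (allPortals H) (EQ c ∣ H ∣ᵥ)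
allPortals-realizes-EQ {c} H c≤1 v = strictlyRealizes-EQ (allPortals H) packing constant
  where
  distinct : ∀ y → y ≤ 1 → Distinct (replicate y (identityCopy H))
  distinct zero _ = []
  distinct (suc zero) _ = [] ∷ []
  distinct (suc (suc y)) (s≤s ())

  packing : ∀ y → y ≤ c →
    ∃ λ Zs → DistinctPacking c H H Zs × Realizes-by c H (allPortals H) (λ _ → y) Zs
  packing y y≤c =
    replicate y (identityCopy H) ,
    (distinct y (≤-trans y≤c c≤1) , λ x → subst (_≤ c) (sym (mult≡y x)) y≤c) ,
    (λ x x-internal → contradiction (x , refl) x-internal) , mult≡y
    where
    mult≡y : ∀ x → mult (replicate y (identityCopy H)) x ≡ y
    mult≡y x = trans (mult-spanning (replicate y (identityCopy H)) x) (length-replicate y)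

  constant : ∀ r → (∀ i → r i ≤ c) → ∀ Zs → Realizes-by c H (allPortals H) r Zs → EQ c ∣ H ∣ᵥ r
  constant r r≤c Zs (_ , portals) = length Zs , subst (_≤ c) (r≡length v) (r≤c v) , r≡length
    where
    r≡length : ∀ i → r i ≡ length Zs
    r≡length i = trans (sym (portals i)) (mult-spanning Zs i)

-- The complete d-partite gadget with parts of size c + 1 (H = K d)

module MultipartiteGadget (d′ c : ℕ) where

  d : ℕ
  d = suc d′

  vertex : Fin d → Fin (suc c) → Fin (d * suc c)
  vertex = combine

  part : Fin (d * suc c) → Fin d
  part x = proj₁ (remQuot {d} (suc c) x)

  slot : Fin (d * suc c) → Fin (suc c)
  slot x = proj₂ (remQuot {d} (suc c) x)

  part-vertex : ∀ i s → part (vertex i s) ≡ i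
  part-vertex i s = cong proj₁ (remQuot-combine i s)

  vertex-part-slot : ∀ x → vertex (part x) (slot x) ≡ x
  vertex-part-slot = combine-remQuot {d} (suc c)

  gadget : Gadget d
  gadget = record
    { graph     = completeMultipartite part
    ; portal    = λ i → vertex i zero
    ; portalInj = λ {i} {j} → combine-injectiveˡ i zero j zero
    }

  internal-suc : ∀ i t → Internal gadget (vertex i (suc t))
  internal-suc i t (j , eq) with combine-injectiveʳ j zero i (suc t) eq
  ... | ()

  Copy : Set
  Copy = Emb (K d) (graph gadget)

  covers-vertex : ∀ (Z : Copy) {u i t} → map Z u ≡ vertex i t → ∀ s → covers Z (vertex i s) ≡ does (s ≟ t)
  covers-vertex Z {u} {i} {t} Zu≡it s = does-⇔ (mk⇔ to from) (any? (λ v → map Z v ≟ vertex i s)) (s ≟ t)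
    where
    to : (∃ λ v → map Z v ≡ vertex i s) → s ≡ t
    to (v , Zv≡is) with part-injective part Z
      (trans (cong part Zv≡is) (trans (part-vertex i s) (sym (trans (cong part Zu≡it) (part-vertex i t)))))
    ... | refl = combine-injectiveʳ i s i t (trans (sym Zv≡is) Zu≡it)
    from : s ≡ t → ∃ λ v → map Z v ≡ vertex i s
    from refl = u , Zu≡it

  ∑-covers-part : ∀ (Z : Copy) i → ∑[ s < suc c ] indicator (covers Z (vertex i s)) ≡ 1
  ∑-covers-part Z i = begin
    ∑[ s < suc c ] indicator (covers Z (vertex i s))
      ≡⟨ sum-cong-≗ (λ s → cong indicator (covers-vertex Z {i = i} {t = t} Zu≡it s)) ⟩
    ∑[ s < suc c ] δ s t
      ≡⟨ sum-cong-≗ {suc c} (λ s → δ-comm s t) ⟩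
    ∑[ s < suc c ] δ t s
      ≡⟨ ∑-δ t ⟩
    1 ∎
    where
    hit : ∃ λ u → part (map Z u) ≡ i
    hit = injective⇒surjective (part ∘ map Z) (part-injective part Z) i
    t : Fin (suc c)
    t = slot (map Z (proj₁ hit))
    Zu≡it : map Z (proj₁ hit) ≡ vertex i t
    Zu≡it = trans (sym (vertex-part-slot (map Z (proj₁ hit)))) (cong (λ j → vertex j t) (proj₂ hit))

  ∑-mult-part : ∀ (Zs : List Copy) i → ∑[ s < suc c ] mult Zs (vertex i s) ≡ length Zs
  ∑-mult-part [] i = sum-replicate-zero (suc c)
  ∑-mult-part (Z ∷ Zs) i =
    trans (∑-distrib-+ (λ s → indicator (covers Z (vertex i s))) (λ s → mult Zs (vertex i s)))
          (cong₂ _+_ (∑-covers-part Z i) (∑-mult-part Zs i))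

  realizing⇒EQ : ∀ r → (∀ i → r i ≤ c) → ∀ Zs → Realizes-by c (K d) gadget r Zs → EQ c d r
  realizing⇒EQ r r≤c Zs (internal , portals) =
    r zero , r≤c zero , λ i → +-cancelʳ-≡ _ (r i) (r zero) (trans (count i) (sym (count zero)))
    where
    count : ∀ i → r i + ∑[ t < c ] c ≡ length Zs
    count i = begin
      r i + ∑[ t < c ] c
        ≡⟨ cong₂ _+_ (portals i) (sum-cong-≗ {c} (λ t → internal _ (internal-suc i t))) ⟨
      ∑[ s < suc c ] mult Zs (vertex i s)
        ≡⟨ ∑-mult-part Zs i ⟩
      length Zs ∎

  Pair : Set
  Pair = Fin (suc c) × Fin (suc c)

  pairSlot : ∀ {A : Set} → A × A → Fin d → A
  pairSlot (a , b) zero    = a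
  pairSlot (a , b) (suc _) = b

  pairCopy : Pair → Copy
  pairCopy p = sectionCopy part (λ i → vertex i (pairSlot p i)) (λ i → part-vertex i (pairSlot p i))

  pairCopy-injective : Fin d′ → ∀ {p q} → SameCopy (pairCopy p) (pairCopy q) → p ≡ q
  pairCopy-injective j {p} {q} same = cong₂ _,_ (slot≡ zero) (slot≡ (suc j))
    where
    slot≡ : ∀ i → pairSlot p i ≡ pairSlot q i
    slot≡ i = combine-injectiveʳ i _ i _
      (sectionCopy-injective part (λ i → part-vertex i (pairSlot p i))
                                  (λ i → part-vertex i (pairSlot q i)) same i)

  pairCount : Fin d → Fin (suc c) → List Pair → ℕ
  pairCount i s ps = sum (List.map (λ p → δ s (pairSlot p i)) ps)

  mult-pairCopies : ∀ ps i s → mult (List.map pairCopy ps) (vertex i s) ≡ pairCount i s ps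
  mult-pairCopies [] i s = refl
  mult-pairCopies (p ∷ ps) i s =
    cong₂ _+_ (cong indicator (covers-vertex (pairCopy p) {u = i} {i = i} refl s)) (mult-pairCopies ps i s)

  diagonal : ℕ → Fin c → List Pair
  diagonal y a = if toℕ a <ᵇ y then (zero , suc a) ∷ (suc a , zero) ∷ [] else (suc a , suc a) ∷ []

  block : ℕ → Fin c → Fin c → List Pair
  block y a b = if does (a ≟ b) then diagonal y a else (suc a , suc b) ∷ []

  pairCount-block-portal : ∀ y a b i → pairCount i zero (block y a b) ≡ δ a b * indicator (toℕ a <ᵇ y)
  pairCount-block-portal y a b i with a ≟ b | toℕ a <ᵇ y | i
  ... | no _     | _     | zero  = refl
  ... | no _     | _     | suc _ = refl
  ... | yes refl | true  | zero  = refl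
  ... | yes refl | true  | suc _ = refl
  ... | yes refl | false | zero  = refl
  ... | yes refl | false | suc _ = refl

  pairCount-block-internal : ∀ y a b i t → pairCount i (suc t) (block y a b) ≡ δ t (pairSlot (a , b) i)
  pairCount-block-internal y a b i t with a ≟ b | toℕ a <ᵇ y | i
  ... | no _     | _     | zero  = +-identityʳ _
  ... | no _     | _     | suc _ = +-identityʳ _
  ... | yes refl | true  | zero  = +-identityʳ _
  ... | yes refl | true  | suc _ = +-identityʳ _
  ... | yes refl | false | zero  = +-identityʳ _
  ... | yes refl | false | suc _ = +-identityʳ _

  pairs : ℕ → List Pair
  pairs y = concat (tabulate λ a → concat (tabulate (block y a)))

  copies : ℕ → List Copy
  copies y = List.map pairCopy (pairs y)

  mult-copies : ∀ y i s → mult (copies y) (vertex i s) ≡ ∑[ a < c ] ∑[ b < c ] pairCount i s (block y a b)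
  mult-copies y i s =
    trans (mult-pairCopies (pairs y) i s)
      (trans (sum-map-concat-tabulate (λ p → δ s (pairSlot p i)) (λ a → concat (tabulate (block y a))))
             (sum-cong-≗ {c} (λ a → sum-map-concat-tabulate (λ p → δ s (pairSlot p i)) (block y a))))

  mult-copies-portal : ∀ {y} → y ≤ c → ∀ i → mult (copies y) (vertex i zero) ≡ y
  mult-copies-portal {y} y≤c i = begin
    mult (copies y) (vertex i zero)
      ≡⟨ mult-copies y i zero ⟩
    ∑[ a < c ] ∑[ b < c ] pairCount i zero (block y a b)
      ≡⟨ sum-cong-≗ {c} (λ a → sum-cong-≗ {c} (λ b → pairCount-block-portal y a b i)) ⟩
    ∑[ a < c ] ∑[ b < c ] (δ a b * indicator (toℕ a <ᵇ y))
      ≡⟨ sum-cong-≗ {c} (λ a → ∑-δ-* a _) ⟩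
    ∑[ a < c ] indicator (toℕ a <ᵇ y)
      ≡⟨ ∑-< y≤c ⟩
    y ∎

  ∑∑-δ-pairSlot : ∀ i t → ∑[ a < c ] ∑[ b < c ] δ t (pairSlot (a , b) i) ≡ c
  ∑∑-δ-pairSlot zero t = begin
    ∑[ a < c ] ∑[ b < c ] δ t a ≡⟨ ∑-comm {c} {c} (λ a b → δ t a) ⟩
    ∑[ b < c ] ∑[ a < c ] δ t a ≡⟨ sum-cong-≗ {c} (λ _ → ∑-δ t) ⟩
    ∑[ b < c ] 1                ≡⟨ ∑-one c ⟩
    c                           ∎
  ∑∑-δ-pairSlot (suc _) t = trans (sum-cong-≗ {c} (λ _ → ∑-δ t)) (∑-one c)

  mult-copies-internal : ∀ y i t → mult (copies y) (vertex i (suc t)) ≡ c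
  mult-copies-internal y i t = begin
    mult (copies y) (vertex i (suc t))
      ≡⟨ mult-copies y i (suc t) ⟩
    ∑[ a < c ] ∑[ b < c ] pairCount i (suc t) (block y a b)
      ≡⟨ sum-cong-≗ {c} (λ a → sum-cong-≗ {c} (λ b → pairCount-block-internal y a b i t)) ⟩
    ∑[ a < c ] ∑[ b < c ] δ t (pairSlot (a , b) i)
      ≡⟨ ∑∑-δ-pairSlot i t ⟩
    c ∎

  blockKey : Pair → Pair
  blockKey (zero , b)      = b , b
  blockKey (suc a , zero)  = suc a , suc a
  blockKey (suc a , suc b) = suc a , suc b

  block-keyed : ∀ y a b → All (λ p → blockKey p ≡ (suc a , suc b)) (block y a b)
  block-keyed y a b with a ≟ b | toℕ a <ᵇ y
  ... | no _     | _     = refl ∷ []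
  ... | yes refl | true  = refl ∷ refl ∷ []
  ... | yes refl | false = refl ∷ []

  block-unique : ∀ y a b → Unique (block y a b)
  block-unique y a b with a ≟ b | toℕ a <ᵇ y
  ... | no _     | _     = [] ∷ []
  ... | yes refl | true  = ((λ ()) ∷ []) ∷ [] ∷ []
  ... | yes refl | false = [] ∷ []

  pairs-unique : ∀ y → Unique (pairs y)
  pairs-unique y = unique-concat-tabulate _ (proj₁ ∘ blockKey) suc suc-injective
    (λ a → All.concat⁺ (All.tabulate⁺ (λ b → All.map (cong proj₁) (block-keyed y a b))))
    (λ a → unique-concat-tabulate (block y a) (proj₂ ∘ blockKey) suc suc-injective
             (λ b → All.map (cong proj₂) (block-keyed y a b)) (block-unique y a))

  copies-distinct : Fin d′ → ∀ y → Distinct (copies y)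
  copies-distinct j y =
    AllPairs.map⁺ (AllPairs.map (λ p≢q same → p≢q (pairCopy-injective j same)) (pairs-unique y))

  copies-realize : Fin d′ → ∀ y → y ≤ c →
    ∃ λ Zs → DistinctPacking c (K d) (graph gadget) Zs × Realizes-by c (K d) gadget (λ _ → y) Zs
  copies-realize j y y≤c = copies y , (copies-distinct j y , packing) , internal , mult-copies-portal y≤c
    where
    packing : MultiPacking c (K d) (graph gadget) (copies y)
    packing x with combine-surjective {d} {suc c} x
    ... | i , zero  , refl = ≤-trans (≤-reflexive (mult-copies-portal y≤c i)) y≤c
    ... | i , suc t , refl = ≤-reflexive (mult-copies-internal y i t)
    internal : ∀ x → Internal gadget x → mult (copies y) x ≡ c
    internal x x-internal with combine-surjective {d} {suc c} x
    ... | i , zero  , refl = contradiction (i , refl) x-internal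
    ... | i , suc t , refl = mult-copies-internal y i t

  realizes-EQ : Fin d′ → StrictlyRealizes c (K d) gadget (EQ c d)
  realizes-EQ j = strictlyRealizes-EQ gadget (copies-realize j) realizing⇒EQ

mainTheorem12 : (c : ℕ) (H : Graph) → Hyp c H →
    Σ (Gadget ∣ H ∣ᵥ) (λ G → Coherent c H G × StrictlyRealizes c H G (EQ c ∣ H ∣ᵥ))
mainTheorem12 c H (inj₁ (_ , suc (suc e) , s≤s (s≤s _) , refl)) =
  gadget , K-coherent c _ gadget , realizes-EQ zero
  where open MultipartiteGadget (suc e) c
mainTheorem12 c H (inj₂ (refl , 3≤∣H∣)) =
  allPortals H , allPortals-coherent 1 H ,
  allPortals-realizes-EQ H ≤-refl (fromℕ< (≤-trans (s≤s z≤n) 3≤∣H∣))
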